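{- If $G$ is a finite graph of order $n\ge 2$ and $\overline{G}$ is its complement, then $4\le b(G)+b(\overline{G})\le n+2$.
   Context: Graphs here need not be connected. Burning process on a finite graph: in round 1 one node is chosen and burned; in each round $t\ge 2$, every unburned neighbour of a node burned by the end of round $t-1$ becomes burned, and one additional unburned node (if available) is chosen and burned; burned nodes stay burned. The burning number $b(\cdot)$ is the minimum number of rounds needed until all nodes are burned. -}

module Defs where

open import Level using (0ℓ)
open import Data.Nat using (ℕ; suc; _≤_)
open import Data.Fin using (Fin)
open import Data.Fin.Properties using (_≟_)
open import Data.Bool using (Bool; true; false; not; _∧_)
open import Data.Product using (Σ; _×_; ∃-syntax)
open import Data.Sum using (_⊎_)
open import Relation.Nullary using (¬_)
open import Relation.Nullary.Decidable using (⌊_⌋)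
open import Relation.Binary.PropositionalEquality using (_≡_)

-- A finite simple graph on the vertex set Fin n (order n), not necessarily connected.
record Graph (n : ℕ) : Set where
  field
    adj   : Fin n → Fin n → Bool
    sym   : ∀ u v → adj u v ≡ adj v u
    irrefl : ∀ v → adj v v ≡ false
open Graph public

complement : ∀ {n} → Graph n → Graph n
complement {n} G = record { adj = a ; sym = s ; irrefl = i }
  where
  a : Fin n → Fin n → Bool
  a u v = not (adj G u v) ∧ not ⌊ u ≟ v ⌋
  s : ∀ u v → a u v ≡ a v u
  s u v rewrite sym G u v with u ≟ v | v ≟ u
  ... | Relation.Nullary.yes _ | Relation.Nullary.yes _ = Relation.Binary.PropositionalEquality.refl
  ... | Relation.Nullary.no _  | Relation.Nullary.no _  = Relation.Binary.PropositionalEquality.refl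
  ... | Relation.Nullary.yes p | Relation.Nullary.no q  = Data.Empty.⊥-elim (q (Relation.Binary.PropositionalEquality.sym p))
    where import Data.Empty
  ... | Relation.Nullary.no q  | Relation.Nullary.yes p = Data.Empty.⊥-elim (q (Relation.Binary.PropositionalEquality.sym p))
    where import Data.Empty
  i : ∀ v → a v v ≡ false
  i v with v ≟ v
  ... | Relation.Nullary.yes _ = Data.Bool.Properties.∧-zeroʳ (not (adj G v v))
    where import Data.Bool.Properties
  ... | Relation.Nullary.no q = Data.Empty.⊥-elim (q Relation.Binary.PropositionalEquality.refl)
    where import Data.Empty

VSet : ℕ → Set₁
VSet n = Fin n → Set

Spread : ∀ {n} → Graph n → VSet n → VSet n
Spread G B v = B v ⊎ (∃[ u ] (B u × adj G u v ≡ true))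

-- Run G t B : some legal execution of the burning process on G has, by the end
-- of round t, exactly the burned set B.
--  round 1: one vertex is chosen and burned;
--  round t ≥ 2: fire spreads to neighbours of vertices burned by round t-1, and one
--  additional still-unburned vertex is chosen and burned, if one is available.
data Run {n : ℕ} (G : Graph n) : ℕ → VSet n → Set₁ where
  start  : (x : Fin n) → Run G 1 (λ v → v ≡ x)
  choose : ∀ {t B} → Run G t B → (x : Fin n) → ¬ Spread G B x →
           Run G (suc t) (λ v → Spread G B v ⊎ v ≡ x)
  none   : ∀ {t B} → Run G t B → (∀ v → Spread G B v) →
           Run G (suc t) (Spread G B)

BurnsIn : ∀ {n} → Graph n → ℕ → Set₁
BurnsIn G k = Σ (VSet _) λ B → Run G k B × (∀ v → B v)

IsBurningNumber : ∀ {n} → Graph n → ℕ → Set₁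
IsBurningNumber G k = BurnsIn G k × (∀ j → BurnsIn G j → k ≤ j)

module Submission where

-- Lower bound: round 1 burns a single vertex, so a graph with two distinct
-- vertices needs at least two rounds; this holds for G and for Ḡ alike.
--
-- Upper bound: burn a fixed vertex v in round 1.  After the fire spreads in
-- round 2 the closed neighbourhood N[v] is burned, and from then on every
-- round burns at least one new vertex (the chosen one).  Hence if u vertices
-- lie outside N_H[v], then b(H) ≤ 2 + pred u.  Every vertex other than v is
-- adjacent to v in exactly one of G and Ḡ, so the vertices outside N_G[v] all
-- lie in N_Ḡ[v] ∖ {v}, giving u_G + u_Ḡ < n, and the bound follows.

open import Defs hiding (sym)
open import Data.Nat using (ℕ; zero; suc; pred; _+_; _∸_; _≤_; _<_; _≤′_; ≤′-refl; ≤′-step; z≤n; s≤s)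
open import Data.Nat.Properties
  using (≤-refl; ≤-trans; ≤-reflexive; ≤-pred; ≤⇒≤′; m<m+n; m∸n+n≡m; n≤1+n; +-comm; +-suc; +-identityʳ;
         +-mono-≤; +-monoʳ-<; module ≤-Reasoning)
open import Data.Bool using (true; false; not)
import Data.Bool.Properties as Bool
open import Data.Fin using (Fin; zero; suc)
open import Data.Fin.Properties using (_≟_; all?; any?; ¬∀⟶∃¬)
open import Data.Fin.Subset using (Subset; _∈_; ∣_∣)
open import Data.Fin.Subset.Properties using (p⊆q⇒∣p∣≤∣q∣; p⊂q⇒∣p∣<∣q∣; ∣∁p∣≡n∸∣p∣; ∣p∣≤n)
open import Data.Vec using (tabulate)
open import Data.Vec.Properties using (lookup∘tabulate; tabulate-∘; lookup⇒[]=; []=⇒lookup)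
open import Data.Product using (_×_; _,_)
open import Data.Sum using (inj₁; inj₂)
open import Data.Empty using (⊥-elim)
open import Function using (_∘_)
open import Relation.Nullary using (¬_; yes; no; does)
open import Relation.Nullary.Decidable using (dec-true; decidable-stable; _⊎-dec_; _×-dec_)
open import Relation.Unary using (Decidable; _⊆_)
open import Relation.Unary.Properties using (∁?; ∅?; _∪?_)
open import Relation.Binary.PropositionalEquality using (_≡_; _≢_; refl; sym; trans; cong; subst)

module _ {n : ℕ} where

  toSubset : {P : VSet n} → Decidable P → Subset n
  toSubset P? = tabulate (does ∘ P?)

  count : {P : VSet n} → Decidable P → ℕ
  count P? = ∣ toSubset P? ∣

  module _ {P : VSet n} (P? : Decidable P) where

    ∈-toSubset : ∀ {x} → P x → x ∈ toSubset P?
    ∈-toSubset {x} px = lookup⇒[]= x _ (trans (lookup∘tabulate (does ∘ P?) x) (dec-true (P? x) px))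

    ∈-toSubset⁻ : ∀ {x} → x ∈ toSubset P? → P x
    ∈-toSubset⁻ {x} x∈ with P? x | trans (sym (lookup∘tabulate (does ∘ P?) x)) ([]=⇒lookup x∈)
    ... | yes px | _ = px

    count≤n : count P? ≤ n
    count≤n = ∣p∣≤n (toSubset P?)

    count-∁ : count (∁? P?) ≡ n ∸ count P?
    count-∁ = trans (cong ∣_∣ (tabulate-∘ not (does ∘ P?))) (∣∁p∣≡n∸∣p∣ (toSubset P?))

  module _ {P Q : VSet n} (P? : Decidable P) (Q? : Decidable Q) where

    count-mono : P ⊆ Q → count P? ≤ count Q?
    count-mono P⊆Q = p⊆q⇒∣p∣≤∣q∣ (∈-toSubset Q? ∘ P⊆Q ∘ ∈-toSubset⁻ P?)

    count-strict : P ⊆ Q → ∀ {x} → Q x → ¬ P x → count P? < count Q?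
    count-strict P⊆Q {x} qx ¬px =
      p⊂q⇒∣p∣<∣q∣ ((∈-toSubset Q? ∘ P⊆Q ∘ ∈-toSubset⁻ P?) , x , ∈-toSubset Q? qx , ¬px ∘ ∈-toSubset⁻ P?)

  count-zero : {P : VSet n} (P? : Decidable P) → count P? ≤ 0 → ∀ x → ¬ P x
  count-zero P? c x px with ≤-trans (count-strict ∅? P? (λ ()) px (λ ())) c
  ... | ()

module _ {n : ℕ} (G : Graph n) where

  spread? : {B : VSet n} → Decidable B → Decidable (Spread G B)
  spread? B? v = B? v ⊎-dec any? (λ u → B? u ×-dec (adj G u v Bool.≟ true))

  burnsIn-suc : ∀ {k} → BurnsIn G k → BurnsIn G (suc k)
  burnsIn-suc (B , run , all) = Spread G B , none run (inj₁ ∘ all) , inj₁ ∘ all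

  burnsIn-mono : ∀ {k m} → BurnsIn G k → k ≤ m → BurnsIn G m
  burnsIn-mono b = go ∘ ≤⇒≤′
    where
    go : ∀ {m} → _ ≤′ m → BurnsIn G m
    go ≤′-refl       = b
    go (≤′-step k≤m) = burnsIn-suc (go k≤m)

  -- Each round burns at least one new vertex until all are burned, so a run
  -- with r unburned vertices at round t finishes by round t + r ...
  finish : ∀ r {t B} → Run G t B → (B? : Decidable B) →
           count (∁? B?) ≤ r → BurnsIn G (t + r)

  finish-after-spread : ∀ r {t B} → Run G t B → (B? : Decidable B) →
                        count (∁? (spread? B?)) ≤ suc r → BurnsIn G (t + suc r)

  finish zero {t} {B} run B? c =
    subst (BurnsIn G) (sym (+-identityʳ t)) (B , run , λ v → decidable-stable (B? v) (count-zero (∁? B?) c v))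
  finish (suc r) run B? c =
    finish-after-spread r run B? (≤-trans (count-mono (∁? (spread? B?)) (∁? B?) (λ ¬s b → ¬s (inj₁ b))) c)

  finish-after-spread r {t} {B} run B? c with all? (spread? B?)
  ... | yes all = burnsIn-mono (Spread G B , none run all , all) (m<m+n t (s≤s z≤n))
  ... | no ¬all with ¬∀⟶∃¬ n _ (spread? B?) ¬all
  ... | x , x∉ = subst (BurnsIn G) (sym (+-suc t r)) (finish r (choose run x x∉) B'? fewer)
    where
    B'? = spread? B? ∪? (_≟ x)
    -- Choosing x burns it in addition to the spread set.
    fewer : count (∁? B'?) ≤ r
    fewer = ≤-pred (≤-trans (count-strict (∁? B'?) (∁? (spread? B?)) (λ ¬b' s → ¬b' (inj₁ s))
                                          x∉ (λ ¬b' → ¬b' (inj₂ refl))) c)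

  outside : Fin n → ℕ
  outside v = count (∁? (spread? (_≟ v)))

  burn-from : ∀ v → BurnsIn G (2 + pred (outside v))
  burn-from v = finish-after-spread (pred (outside v)) (start v) (_≟ v) (≤-suc-pred (outside v))
    where
    ≤-suc-pred : ∀ m → m ≤ suc (pred m)
    ≤-suc-pred zero    = z≤n
    ≤-suc-pred (suc m) = ≤-refl

  round-one-single : ∀ {B x y} → Run G 1 B → B x → B y → x ≡ y
  round-one-single (start z) refl refl = refl
  round-one-single (choose () _ _)
  round-one-single (none () _)

  two-rounds-needed : ∀ {x y k} → x ≢ y → BurnsIn G k → 2 ≤ k
  two-rounds-needed {k = zero}          _   (_ , () , _)
  two-rounds-needed {k = suc zero}      x≢y (_ , run , all) = ⊥-elim (x≢y (round-one-single run (all _) (all _)))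
  two-rounds-needed {k = suc (suc _)}   _   _ = s≤s (s≤s z≤n)

complement-adj : ∀ {n} (G : Graph n) {u w} → adj G u w ≡ false → u ≢ w → adj (complement G) u w ≡ true
complement-adj G {u} {w} e u≢w rewrite e with u ≟ w
... | yes u≡w = ⊥-elim (u≢w u≡w)
... | no _    = refl

module _ {n : ℕ} (G : Graph n) (v : Fin n) where

  private
    Ḡ = complement G

  neighbourhoods-cover : ∀ u → ¬ Spread Ḡ (_≡ v) u → Spread G (_≡ v) u
  neighbourhoods-cover u ¬inḠ with u ≟ v | adj G v u in e
  ... | yes u≡v | _     = inj₁ u≡v
  ... | no _    | true  = inj₂ (v , refl , e)
  ... | no u≢v  | false = ⊥-elim (¬inḠ (inj₂ (v , refl , complement-adj G e (u≢v ∘ sym))))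

  -- Hence the vertices outside N_G[v] and those outside N_Ḡ[v] number
  -- fewer than n in total: the latter lie inside N_G[v] ∖ {v}.
  outside-sum : outside G v + outside Ḡ v < n
  outside-sum = begin-strict
    outside G v + outside Ḡ v  ≡⟨ cong (_+ outside Ḡ v) (count-∁ SG?) ⟩
    (n ∸ a) + outside Ḡ v      <⟨ +-monoʳ-< (n ∸ a) outsideḠ<a ⟩
    (n ∸ a) + a                ≡⟨ m∸n+n≡m (count≤n SG?) ⟩
    n                          ∎
    where
    open ≤-Reasoning
    SG? = spread? G (_≟ v)
    a = count SG?
    outsideḠ<a : outside Ḡ v < a
    outsideḠ<a = count-strict (∁? (spread? Ḡ (_≟ v))) SG? (neighbourhoods-cover _) (inj₁ refl) (λ h → h (inj₁ refl))

-- The per-graph bounds 2 + pred u and 2 + pred u' add up to at most n + 2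
-- whenever u + u' < n (the case u = u' = 0 uses n ≥ 2).
pred-bounds-sum : ∀ {n} u u' → 2 ≤ n → u + u' < n → (2 + pred u) + (2 + pred u') ≤ n + 2
pred-bounds-sum {n} u u' 2≤n u+u'<n =
  ≤-trans (s≤s (s≤s (bound u u' u+u'<n))) (≤-reflexive (+-comm 2 n))
  where
  bound : ∀ u u' → u + u' < n → pred u + suc (suc (pred u')) ≤ n
  bound zero    zero     _  = 2≤n
  bound zero    (suc b)  lt = lt
  bound (suc a) zero     lt = ≤-trans (≤-reflexive (trans (+-comm a 2) (cong (λ c → 2 + c) (sym (+-identityʳ a))))) lt
  bound (suc a) (suc b)  lt = ≤-trans (≤-reflexive (+-suc a (suc b))) (≤-trans (n≤1+n _) lt)

theorem18 : (n : ℕ) → 2 ≤ n → (G : Graph n) → (k k' : ℕ) →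
    IsBurningNumber G k → IsBurningNumber (complement G) k' →
    (4 ≤ k + k') × (k + k' ≤ n + 2)
theorem18 zero          ()
theorem18 (suc zero)    (s≤s ())
theorem18 (suc (suc m)) 2≤n G k k' (burnsG , minimalG) (burnsḠ , minimalḠ) =
  +-mono-≤ (two-rounds-needed G 0≢1 burnsG) (two-rounds-needed Ḡ 0≢1 burnsḠ) ,
  ≤-trans (+-mono-≤ (minimalG _ (burn-from G v)) (minimalḠ _ (burn-from Ḡ v)))
          (pred-bounds-sum (outside G v) (outside Ḡ v) 2≤n (outside-sum G v))
  where
  Ḡ = complement G
  v : Fin (suc (suc m))
  v = zero
  0≢1 : v ≢ suc zero
  0≢1 ()
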